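{- Let $Y$ be the total number of haplotype intervals over all haplotypes. During the decomposition algorithm with parameter $d>1$, an Active Split step is triggered at most $\left\lceil\frac{Y}{d-1}\right\rceil$ times; hence at most $\left\lceil\frac{Y}{d-1}\right\rceil$ canonical refined segments are created.
   Context: Setting: haplotypes $S_1,\dots,S_h$ of length $m$; prefix array $\mathrm{PA}$ ($h\times m$, column $1$ is $1,\dots,h$, column $j>1$ sorts indices by co-lexicographic order of $S_i[1..j-1]$, ties broken stably); PBWT with $\mathrm{col}_j(\mathrm{PBWT})[x]=S_{\mathrm{col}_j(\mathrm{PA})[x]}[j]$; $(x,j)$ is a run-top if $x=1$ or $\mathrm{col}_j(\mathrm{PBWT})[x]\ne\mathrm{col}_j(\mathrm{PBWT})[x-1]$. For $\mathrm{col}_j(\mathrm{PA})[x]=i$: $\phi_j(i)=0$ if $x=1$, else $\phi_j(i)=\mathrm{col}_j(\mathrm{PA})[x-1]$. Haplotype intervals of $S_i$: with $b_1<\dots<b_k=m$ the set of $m$ and all columns $j$ such that some run-top $(x,j)$ has $\mathrm{col}_j(\mathrm{PA})[x]=i$, they are $[1,b_1],[b_1+1,b_2],\dots,[b_{k-1}+1,b_k]$. Two intervals overlap if they share an integer. Decomposition algorithm with integer parameter $d>1$: initially, for each $c$, $L_c$ is the linked list of haplotype intervals of $S_c$ in increasing order and $\mathrm{RS}[c]$ is empty. For $j=1,\dots,m$ and, within each $j$, for $i=1,\dots,h$: let $c=\mathrm{col}_j(\mathrm{PA})[i]$ and let $[b_c,e_c]$ be the first interval of $L_c$. If $j=e_c$,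 remove $[b_c,e_c]$ from $L_c$ and append it to the tail of $\mathrm{RS}[c]$ (Passive Split). Otherwise, if $i>1$ and $[b_c,j]$ overlaps exactly $d$ refined segments currently in $\mathrm{RS}[c']$, where $c'=\mathrm{col}_j(\mathrm{PA})[i-1]$, append $[b_c,j]$ to $\mathrm{RS}[c]$ and replace the head $[b_c,e_c]$ of $L_c$ by $[j+1,e_c]$ (Active Split). Intervals in the lists $\mathrm{RS}[\cdot]$ are called refined segments; a refined segment is canonical if it was produced by an Active Split step. -}

module Defs where

open import Data.Nat using (ℕ; zero; suc; _+_; _∸_; _<ᵇ_; _≡ᵇ_; _≤ᵇ_; _⊔_; _⊓_)
open import Data.Nat.DivMod using (_/_)
open import Data.Bool using (Bool; true; false; if_then_else_; _∧_; _∨_; not)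
open import Data.List using (List; []; _∷_; map; foldl; length; applyUpTo; _++_; [_])
open import Data.Nat.ListAction using (sum)
open import Data.Bool.ListAction using (any)
open import Data.Product using (_×_; _,_; proj₁; proj₂)

-- Conventions (1-based, as in the paper):
--   h haplotypes S 1 .. S h, each of length m; S i j is the j-th symbol
--   of haplotype i (values of S outside 1≤i≤h, 1≤j≤m are irrelevant).

Haps : Set
Haps = ℕ → ℕ → ℕ

range1 : ℕ → List ℕ
range1 n = applyUpTo suc n

-- 1-based lookup with default 0
at : List ℕ → ℕ → ℕ
at []       _             = 0
at (x ∷ xs) zero          = 0
at (x ∷ xs) (suc zero)    = x
at (x ∷ xs) (suc (suc k)) = at xs (suc k)

-- Co-lexicographic strict order on prefixes S_i[1..j-1], ties broken
-- by haplotype index (stable sorting starting from 1..h).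

colexLessUpTo : Haps → ℕ → ℕ → ℕ → Bool
colexLessUpTo S zero    i i' = i <ᵇ i'
colexLessUpTo S (suc k) i i' =
  if S i (suc k) ≡ᵇ S i' (suc k)
  then colexLessUpTo S k i i'
  else S i (suc k) <ᵇ S i' (suc k)

colexLess : Haps → ℕ → ℕ → ℕ → Bool
colexLess S j = colexLessUpTo S (j ∸ 1)

insertBy : (ℕ → ℕ → Bool) → ℕ → List ℕ → List ℕ
insertBy lt x []       = x ∷ []
insertBy lt x (y ∷ ys) = if lt x y then x ∷ y ∷ ys else y ∷ insertBy lt x ys

sortBy : (ℕ → ℕ → Bool) → List ℕ → List ℕ
sortBy lt []       = []
sortBy lt (x ∷ xs) = insertBy lt x (sortBy lt xs)

PAcol : Haps → ℕ → ℕ → List ℕ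
PAcol S h j = sortBy (colexLess S j) (range1 h)

PA : Haps → ℕ → ℕ → ℕ → ℕ
PA S h j x = at (PAcol S h j) x

PBWT : Haps → ℕ → ℕ → ℕ → ℕ
PBWT S h j x = S (PA S h j x) j

runTop : Haps → ℕ → ℕ → ℕ → Bool
runTop S h x j with x
... | zero        = false
... | suc zero    = true
... | suc (suc k) = not (PBWT S h j (suc (suc k)) ≡ᵇ PBWT S h j (suc k))

Interval : Set
Interval = ℕ × ℕ   -- [b , e]

isBoundary : Haps → ℕ → ℕ → ℕ → ℕ → Bool
isBoundary S h m i j =
  (j ≡ᵇ m) ∨ any (λ x → runTop S h x j ∧ (PA S h j x ≡ᵇ i)) (range1 h)

boundaries : Haps → ℕ → ℕ → ℕ → List ℕ
boundaries S h m i = filterB (range1 m)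
  where
  filterB : List ℕ → List ℕ
  filterB []       = []
  filterB (j ∷ js) = if isBoundary S h m i j then j ∷ filterB js else filterB js

intervalsFrom : ℕ → List ℕ → List Interval
intervalsFrom start []       = []
intervalsFrom start (b ∷ bs) = (start , b) ∷ intervalsFrom (suc b) bs

hapIntervals : Haps → ℕ → ℕ → ℕ → List Interval
hapIntervals S h m i = intervalsFrom 1 (boundaries S h m i)

totalIntervals : Haps → ℕ → ℕ → ℕ
totalIntervals S h m = sum (map (λ i → length (hapIntervals S h m i)) (range1 h))

overlaps : Interval → Interval → Bool
overlaps (a , b) (a' , b') = (a ⊔ a') ≤ᵇ (b ⊓ b')

-- refined segment together with a flag: true iff canonical (Active Split)
RefSeg : Set
RefSeg = Interval × Bool

record State : Set where
  constructor st
  field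
    L       : ℕ → List Interval
    RS      : ℕ → List RefSeg
    actives : ℕ          -- number of Active Split steps triggered so far
open State public

update : {A : Set} → (ℕ → A) → ℕ → A → ℕ → A
update f c v k = if k ≡ᵇ c then v else f k

countOverlaps : Interval → List RefSeg → ℕ
countOverlaps I rs = length (filter' rs)
  where
  filter' : List RefSeg → List RefSeg
  filter' []             = []
  filter' ((J , t) ∷ js) = if overlaps I J then (J , t) ∷ filter' js else filter' js

step : Haps → ℕ → ℕ → State → ℕ → ℕ → State
step S h d s j i with L s (PA S h j i)
... | []                  = s   -- cannot occur; no-op
... | ((b , e) ∷ rest) =
  let c  = PA S h j i
      c' = PA S h j (i ∸ 1) in
  if j ≡ᵇ e
  then st (update (L s) c rest)
          (update (RS s) c (RS s c ++ [ ((b , e) , false) ]))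
          (actives s)
  else (if (1 <ᵇ i) ∧ (countOverlaps (b , j) (RS s c') ≡ᵇ d)
        then st (update (L s) c ((suc j , e) ∷ rest))
                (update (RS s) c (RS s c ++ [ ((b , j) , true) ]))
                (suc (actives s))
        else s)

initState : Haps → ℕ → ℕ → State
initState S h m = st (hapIntervals S h m) (λ _ → []) 0

runAlg : Haps → ℕ → ℕ → ℕ → State
runAlg S h m d =
  foldl (λ s j → foldl (λ s' i → step S h d s' j i) s (range1 h))
        (initState S h m) (range1 m)

canonicalCount : Haps → ℕ → ℕ → ℕ → ℕ
canonicalCount S h m d =
  sum (map (λ c → length (canon (RS (runAlg S h m d) c))) (range1 h))
  where
  canon : List RefSeg → List RefSeg
  canon []             = []
  canon ((J , t) ∷ js) = if t then (J , t) ∷ canon js else canon js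

-- ⌈ y / k ⌉ for k ≥ 1
ceilDiv : ℕ → ℕ → ℕ
ceilDiv y zero    = 0
ceilDiv y (suc k) = (y + k) / suc k

{-# OPTIONS --safe #-}
module Submission where

-- Amortised counting with credits.  While column j is scanned, haplotype c holds as credit the number of
-- refined segments of φ_j(c), the haplotype just above c, that overlap [b, j], where [b, e] is the head of
-- L_c.  An Active Split of c happens exactly when this credit is d, and leaves c with credit 0.  Appending
-- a refined segment to some RS[c′] raises the total credit by at most one, as φ_j is injective.  Passing to
-- column j + 1 raises no credit: unless column j ends an interval of c, c is not a run-top there and keeps
-- its neighbour, φ_{j+1}(c) = φ_j(c); otherwise c's next interval starts with credit 0.  Hence a Passive
-- Split, which removes an interval from some L_c, does not increase (total credit) + Σ_c |L_c|, and an
-- Active Split lowers it by at least d − 1; so d·A + (total credit) + Σ_c |L_c| ≤ Y + A holds throughout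
-- for the number A of Active Splits, and (d − 1)·A ≤ Y.  Canonical segments are those made by Active Splits.

open import Defs
open import Data.Nat using (ℕ; _≤_; _<_; _∸_)
open import Data.Product using (_×_)

open import Data.Bool using (Bool; true; false; if_then_else_; _∧_; _∨_; T)
open import Data.Bool.ListAction using (any)
open import Data.Bool.Properties using (∧-identityʳ; not-injective; T-∧)
open import Data.Empty using (⊥; ⊥-elim)
open import Data.List using (List; []; _∷_; length; map; foldl; iterate; applyUpTo; _++_; [_])
open import Data.List.Membership.Propositional using (_∈_)
open import Data.List.Membership.Propositional.Properties using (∈-applyUpTo⁺; ∈-applyUpTo⁻)
open import Data.List.Properties using (length-applyUpTo)
open import Data.List.Relation.Binary.Permutation.Propositional using (_↭_; prep; swap; ↭-refl; ↭-trans; ↭-sym)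
open import Data.List.Relation.Binary.Permutation.Propositional.Properties using (All-resp-↭; ∈-resp-↭; ↭-length)
open import Data.List.Relation.Unary.All as All using (All; []; _∷_)
import Data.List.Relation.Unary.All.Properties as All
open import Data.List.Relation.Unary.AllPairs as AllPairs using (AllPairs; []; _∷_)
open import Data.List.Relation.Unary.AllPairs.Properties using (applyUpTo⁺₁)
open import Data.List.Relation.Unary.Any as Any using (here; there)
open import Data.List.Relation.Unary.Any.Properties using (any⁺)
open import Data.Nat using (zero; suc; _+_; _*_; _⊔_; _⊓_; z≤n; s≤s; _≡ᵇ_; _<ᵇ_; _≤ᵇ_)
open import Data.Nat.DivMod using (_/_; m*n/n≡m; /-monoˡ-≤)
open import Data.Nat.ListAction using (sum)
open import Data.Nat.Properties
open import Algebra.Properties.CommutativeSemigroup +-commutativeSemigroup using () renaming (interchange to +-interchange)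
open import Data.Nat.Tactic.RingSolver using (solve-∀)
open import Data.Product using (Σ; ∃-syntax; _,_; proj₁; proj₂)
open import Data.Sum using (_⊎_; inj₁; inj₂)
open import Data.Unit using (⊤; tt)
open import Function using (_∘_)
open import Function.Bundles using (Equivalence)
open import Relation.Binary.Definitions using (tri<; tri≈; tri>)
open import Relation.Binary.PropositionalEquality hiding ([_])
open import Relation.Nullary using (¬_; yes; no; contradiction)
open import Relation.Nullary.Decidable using (dec-true; dec-false)

-- Sums over a list of indices

Distinct : List ℕ → Set
Distinct = AllPairs _≢_

sumOver : List ℕ → (ℕ → ℕ) → ℕ
sumOver ks f = sum (map f ks)

sumOver-zero : ∀ ks {f : ℕ → ℕ} → (∀ {k} → k ∈ ks → f k ≡ 0) → sumOver ks f ≡ 0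
sumOver-zero []       _    = refl
sumOver-zero (k ∷ ks) f≡0 = cong₂ _+_ (f≡0 (here refl)) (sumOver-zero ks (f≡0 ∘ there))

sumOver-mono-+ : ∀ ks {f g g′ : ℕ → ℕ} → (∀ {k} → k ∈ ks → f k ≤ g k + g′ k) →
                 sumOver ks f ≤ sumOver ks g + sumOver ks g′
sumOver-mono-+ []       _ = z≤n
sumOver-mono-+ (k ∷ ks) {f} {g} {g′} f≤ = begin
  f k + sumOver ks f                              ≤⟨ +-mono-≤ (f≤ (here refl)) (sumOver-mono-+ ks (f≤ ∘ there)) ⟩
  (g k + g′ k) + (sumOver ks g + sumOver ks g′)   ≡⟨ +-interchange (g k) (g′ k) _ _ ⟩
  (g k + sumOver ks g) + (g′ k + sumOver ks g′)   ∎
  where open ≤-Reasoning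

sumOver-mono : ∀ ks {f g : ℕ → ℕ} → (∀ {k} → k ∈ ks → f k ≤ g k) → sumOver ks f ≤ sumOver ks g
sumOver-mono []       _   = z≤n
sumOver-mono (k ∷ ks) f≤g = +-mono-≤ (f≤g (here refl)) (sumOver-mono ks (f≤g ∘ there))

sumOver-cong : ∀ ks {f g : ℕ → ℕ} → (∀ {k} → k ∈ ks → f k ≡ g k) → sumOver ks f ≡ sumOver ks g
sumOver-cong []       _   = refl
sumOver-cong (k ∷ ks) f≡g = cong₂ _+_ (f≡g (here refl)) (sumOver-cong ks (f≡g ∘ there))

∈⇒≢ : ∀ {x k} {ks : List ℕ} → All (x ≢_) ks → k ∈ ks → k ≢ x
∈⇒≢ x≢ks k∈ks refl = All.lookup x≢ks k∈ks refl

module _ {c : ℕ} {f f′ : ℕ → ℕ} where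

  sumOver-update : ∀ {ks} → Distinct ks → c ∈ ks → (∀ {k} → k ∈ ks → k ≢ c → f′ k ≡ f k) →
                   sumOver ks f′ + f c ≡ sumOver ks f + f′ c
  sumOver-update {k ∷ ks} (k∉ks ∷ _) (here refl) same =
    trans (cong (λ x → (f′ k + x) + f k) (sumOver-cong ks (λ k′∈ → same (there k′∈) (∈⇒≢ k∉ks k′∈))))
          (exchange (f′ k) (sumOver ks f) (f k))
    where
    exchange : ∀ a b c → (a + b) + c ≡ (c + b) + a
    exchange = solve-∀
  sumOver-update {k ∷ ks} (k∉ks ∷ distinct) (there c∈ks) same =
    trans (+-assoc (f′ k) _ _)
      (trans (cong₂ _+_ (same (here refl) k≢c) (sumOver-update distinct c∈ks (same ∘ there)))
             (sym (+-assoc (f k) _ _)))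
    where
    k≢c : k ≢ c
    k≢c = ≢-sym (∈⇒≢ k∉ks c∈ks)

  sumOver-update-≤ : ∀ {ks} {g : ℕ → ℕ} → Distinct ks → c ∈ ks → f′ c ≡ 0 →
                     (∀ {k} → k ∈ ks → k ≢ c → f′ k ≤ f k + g k) →
                     sumOver ks f′ + f c ≤ sumOver ks f + sumOver ks g
  sumOver-update-≤ {k ∷ ks} {g} (k∉ks ∷ _) (here refl) f′k≡0 bound = begin
    (f′ k + sumOver ks f′) + f k                 ≡⟨ cong (λ x → (x + sumOver ks f′) + f k) f′k≡0 ⟩
    sumOver ks f′ + f k                          ≤⟨ +-monoˡ-≤ (f k) (sumOver-mono-+ ks others) ⟩
    (sumOver ks f + sumOver ks g) + f k          ≤⟨ m≤m+n _ (g k) ⟩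
    (sumOver ks f + sumOver ks g) + f k + g k    ≡⟨ shuffle (f k) (sumOver ks f) (g k) (sumOver ks g) ⟩
    (f k + sumOver ks f) + (g k + sumOver ks g)  ∎
    where
    open ≤-Reasoning
    others : ∀ {k′} → k′ ∈ ks → f′ k′ ≤ f k′ + g k′
    others k′∈ = bound (there k′∈) (∈⇒≢ k∉ks k′∈)
    shuffle : ∀ a b c d → (b + d) + a + c ≡ (a + b) + (c + d)
    shuffle = solve-∀
  sumOver-update-≤ {k ∷ ks} {g} (k∉ks ∷ distinct) (there c∈ks) f′c≡0 bound = begin
    (f′ k + sumOver ks f′) + f c                 ≡⟨ +-assoc (f′ k) _ _ ⟩
    f′ k + (sumOver ks f′ + f c)                 ≤⟨ +-mono-≤ (bound (here refl) (≢-sym (∈⇒≢ k∉ks c∈ks)))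
                                                              (sumOver-update-≤ distinct c∈ks f′c≡0 (bound ∘ there)) ⟩
    (f k + g k) + (sumOver ks f + sumOver ks g)  ≡⟨ +-interchange (f k) (g k) _ _ ⟩
    (f k + sumOver ks f) + (g k + sumOver ks g)  ∎
    where open ≤-Reasoning

sumOver-indicator-≤1 : ∀ {ks} (p : ℕ → Bool) → Distinct ks →
                       (∀ {k k′} → k ∈ ks → k′ ∈ ks → T (p k) → T (p k′) → k ≡ k′) →
                       sumOver ks (λ k → if p k then 1 else 0) ≤ 1
sumOver-indicator-≤1 {[]}     p _                  _      = z≤n
sumOver-indicator-≤1 {k ∷ ks} p (k∉ks ∷ distinct) unique with p k in pk
... | false = sumOver-indicator-≤1 p distinct (λ k∈ k′∈ → unique (there k∈) (there k′∈))
... | true  = s≤s (≤-reflexive (sumOver-zero ks others-zero))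
  where
  others-zero : ∀ {k′} → k′ ∈ ks → (if p k′ then 1 else 0) ≡ 0
  others-zero {k′} k′∈ks with p k′ in pk′
  ... | false = refl
  ... | true  = contradiction (unique (there k′∈ks) (here refl) (subst T (sym pk′) _) (subst T (sym pk) _))
                              (∈⇒≢ k∉ks k′∈ks)

-- Lists of indices: positions and sorting

applyUpTo-iterate : ∀ {f : ℕ → ℕ} a n → (∀ x → f x ≡ a + x) → applyUpTo f n ≡ iterate suc a n
applyUpTo-iterate a zero    _   = refl
applyUpTo-iterate a (suc n) f≗ =
  cong₂ _∷_ (trans (f≗ 0) (+-identityʳ a)) (applyUpTo-iterate (suc a) n (λ x → trans (f≗ (suc x)) (+-suc a x)))

range1-iterate : ∀ n → range1 n ≡ iterate suc 1 n
range1-iterate n = applyUpTo-iterate 1 n (λ _ → refl)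

foldl-iterate-invariant : ∀ {A : Set} (P : ℕ → A → Set) (f : A → ℕ → A) {k} n →
                          (∀ {i x} → k ≤ i → i < k + n → P i x → P (suc i) (f x i)) →
                          ∀ {x} → P k x → P (k + n) (foldl f x (iterate suc k n))
foldl-iterate-invariant P f {k} zero    _    {x} Pkx = subst (λ i → P i x) (sym (+-identityʳ k)) Pkx
foldl-iterate-invariant P f {k} (suc n) step {x} Pkx =
  subst (λ i → P i (foldl f (f x k) (iterate suc (suc k) n))) (sym (+-suc k n))
    (foldl-iterate-invariant P f n (λ {i} k< i< → step (<⇒≤ k<) (subst (i <_) (sym (+-suc k n)) i<))
      (step ≤-refl (subst (k <_) (sym (+-suc k n)) (s≤s (m≤m+n k n))) Pkx))

posOf : ℕ → List ℕ → ℕ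
posOf c []       = 0
posOf c (x ∷ xs) = if x ≡ᵇ c then 1 else suc (posOf c xs)

≡ᵇ-refl : ∀ n → (n ≡ᵇ n) ≡ true
≡ᵇ-refl n = dec-true (n ≟ n) refl

posOf-∈ : ∀ {c xs} → c ∈ xs → ∃[ p ] posOf c xs ≡ suc p × suc p ≤ length xs
posOf-∈ {c} {x ∷ xs} c∈ with x ≟ c
... | yes refl rewrite ≡ᵇ-refl x = 0 , refl , s≤s z≤n
... | no x≢c rewrite dec-false (x ≟ c) x≢c with c∈
...   | here c≡x    = contradiction (sym c≡x) x≢c
...   | there c∈xs  with posOf-∈ c∈xs
...     | p , pos≡ , p<  = suc p , cong suc pos≡ , s≤s p<

at-posOf : ∀ {c xs} → c ∈ xs → at xs (posOf c xs) ≡ c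
at-posOf {c} {x ∷ xs} c∈ with x ≟ c
... | yes refl rewrite ≡ᵇ-refl x = refl
... | no x≢c rewrite dec-false (x ≟ c) x≢c with c∈
...   | here c≡x   = contradiction (sym c≡x) x≢c
...   | there c∈xs with posOf-∈ c∈xs | at-posOf c∈xs
...     | p , pos≡ , _ | at≡ rewrite pos≡ = at≡

at-∈ : ∀ {xs} i → suc i ≤ length xs → at xs (suc i) ∈ xs
at-∈ {x ∷ xs} zero    _         = here refl
at-∈ {x ∷ xs} (suc i) (s≤s i<) = there (at-∈ i i<)

posOf-at : ∀ {xs} i → Distinct xs → suc i ≤ length xs → posOf (at xs (suc i)) xs ≡ suc i
posOf-at {x ∷ xs} zero    _                  _        rewrite ≡ᵇ-refl x = refl
posOf-at {x ∷ xs} (suc i) (x∉xs ∷ distinct) (s≤s i<)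
  rewrite dec-false (x ≟ at xs (suc i)) (≢-sym (∈⇒≢ x∉xs (at-∈ i i<))) = cong suc (posOf-at i distinct i<)

at-≢0 : ∀ xs i → at xs i ≢ 0 → ∃[ p ] i ≡ suc p × suc p ≤ length xs
at-≢0 []       i             at≢0 = contradiction refl at≢0
at-≢0 (x ∷ xs) zero          at≢0 = contradiction refl at≢0
at-≢0 (x ∷ xs) (suc zero)    _    = 0 , refl , s≤s z≤n
at-≢0 (x ∷ xs) (suc (suc i)) at≢0 with at-≢0 xs (suc i) at≢0
... | p , refl , p< = suc p , refl , s≤s p<

posOf-at-≢0 : ∀ {xs i} → Distinct xs → at xs i ≢ 0 → posOf (at xs i) xs ≡ i
posOf-at-≢0 {xs} {i} distinct at≢0 with at-≢0 xs i at≢0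
... | p , refl , p< = posOf-at p distinct p<

before : ℕ → List ℕ → ℕ
before c xs = at xs (posOf c xs ∸ 1)

before-injective : ∀ {xs a b} → Distinct xs → a ∈ xs → b ∈ xs →
                   before a xs ≡ before b xs → before a xs ≢ 0 → a ≡ b
before-injective {xs} {a} {b} distinct a∈ b∈ same ≢0 with posOf-∈ a∈ | posOf-∈ b∈
... | p , pa≡ , _ | q , pb≡ , _ = begin
  a                  ≡⟨ sym (at-posOf a∈) ⟩
  at xs (posOf a xs) ≡⟨ cong (at xs) (trans pa≡ (cong suc p≡q)) ⟩
  at xs (suc q)      ≡⟨ cong (at xs) (sym pb≡) ⟩
  at xs (posOf b xs) ≡⟨ at-posOf b∈ ⟩
  b                  ∎
  where
  open ≡-Reasoning
  p≡q : p ≡ q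
  p≡q = begin
    p                                     ≡⟨ cong (_∸ 1) (sym pa≡) ⟩
    posOf a xs ∸ 1                        ≡⟨ sym (posOf-at-≢0 distinct ≢0) ⟩
    posOf (before a xs) xs                ≡⟨ cong (λ x → posOf x xs) same ⟩
    posOf (before b xs) xs                ≡⟨ posOf-at-≢0 distinct (≢0 ∘ trans same) ⟩
    posOf b xs ∸ 1                        ≡⟨ cong (_∸ 1) pb≡ ⟩
    q                                     ∎

at-sorted : ∀ {R : ℕ → ℕ → Set} {xs} {i k} → AllPairs R xs → i < k → suc k ≤ length xs →
            R (at xs (suc i)) (at xs (suc k))
at-sorted {xs = x ∷ xs} {zero}  {suc k} (x<xs ∷ _)     _         (s≤s k<) = All.lookup x<xs (at-∈ k k<)
at-sorted {xs = x ∷ xs} {suc i} {suc k} (_ ∷ sorted) (s≤s i<k) (s≤s k<) = at-sorted sorted i<k k<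

module StrictlySorted {R : ℕ → ℕ → Set} (irrefl : ∀ {a} → ¬ R a a)
                      (R-trans : ∀ {a b c} → R a b → R b c → R a c)
                      {xs : List ℕ} (sorted : AllPairs R xs) where

  distinct : Distinct xs
  distinct = AllPairs.map (λ { aRb refl → irrefl aRb }) sorted

  private
    at-suc : ∀ {c p} → c ∈ xs → posOf c xs ≡ suc p → at xs (suc p) ≡ c
    at-suc c∈ pos≡ = trans (cong (at xs) (sym pos≡)) (at-posOf c∈)

  posOf-mono : ∀ {a b} → a ∈ xs → b ∈ xs → R a b → posOf a xs < posOf b xs
  posOf-mono {a} {b} a∈ b∈ aRb with posOf-∈ a∈ | posOf-∈ b∈
  ... | p , pa≡ , p< | q , pb≡ , q< rewrite pa≡ | pb≡ with <-cmp p q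
  ... | tri< p<q _ _ = s≤s p<q
  ... | tri≈ _ refl _ = contradiction (subst (R a) (trans (sym (at-suc b∈ pb≡)) (at-suc a∈ pa≡)) aRb) irrefl
  ... | tri> _ _ q<p = contradiction (R-trans aRb (subst₂ R (at-suc b∈ pb≡) (at-suc a∈ pa≡) (at-sorted sorted q<p p<)))
                                     irrefl

  before-adjacent : ∀ {a b} → a ∈ xs → b ∈ xs → R a b → (∀ {z} → z ∈ xs → R a z → R z b → ⊥) →
                    before b xs ≡ a
  before-adjacent {a} {b} a∈ b∈ aRb nothing-between with posOf-∈ a∈ | posOf-∈ b∈ | posOf-mono a∈ b∈ aRb
  ... | p , pa≡ , _ | zero  , pb≡ , _  | pa<pb = contradiction (subst₂ _<_ pa≡ pb≡ pa<pb) λ { (s≤s ()) }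
  ... | p , pa≡ , _ | suc q , pb≡ , q< | pa<pb rewrite pa≡ | pb≡ with m≤n⇒m<n∨m≡n (≤-pred (≤-pred pa<pb))
  ... | inj₂ refl = at-suc a∈ pa≡
  ... | inj₁ p<q  = ⊥-elim (nothing-between (at-∈ q (<⇒≤ q<))
                              (subst (λ x → R x (at xs (suc q))) (at-suc a∈ pa≡) (at-sorted sorted p<q (<⇒≤ q<)))
                              (subst (R (at xs (suc q))) (at-suc b∈ pb≡) (at-sorted sorted (n<1+n q) q<)))

  nothing-between-consecutive : ∀ i {z} → suc (suc i) ≤ length xs → z ∈ xs →
                                R (at xs (suc i)) z → R z (at xs (suc (suc i))) → ⊥
  nothing-between-consecutive i {z} i< z∈ below above = <-irrefl refl (<-≤-trans z<i+2 i+1<z)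
    where
    i+1<z : suc i < posOf z xs
    i+1<z = subst (_< posOf z xs) (posOf-at i distinct (<⇒≤ i<)) (posOf-mono (at-∈ i (<⇒≤ i<)) z∈ below)
    z<i+2 : posOf z xs < suc (suc i)
    z<i+2 = subst (posOf z xs <_) (posOf-at (suc i) distinct i<) (posOf-mono z∈ (at-∈ (suc i) i<) above)

module InsertionSort (lt : ℕ → ℕ → Bool) where

  insertBy-↭ : ∀ x ys → insertBy lt x ys ↭ x ∷ ys
  insertBy-↭ x []       = ↭-refl
  insertBy-↭ x (y ∷ ys) with lt x y
  ... | true  = ↭-refl
  ... | false = ↭-trans (prep y (insertBy-↭ x ys)) (swap y x ↭-refl)

  sortBy-↭ : ∀ xs → sortBy lt xs ↭ xs
  sortBy-↭ []       = ↭-refl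
  sortBy-↭ (x ∷ xs) = ↭-trans (insertBy-↭ x (sortBy lt xs)) (prep x (sortBy-↭ xs))

  module _ (lt-trans : ∀ {a b c} → T (lt a b) → T (lt b c) → T (lt a c))
           (lt-connex : ∀ {a b} → a ≢ b → ¬ T (lt a b) → T (lt b a)) where

    insertBy-sorted : ∀ x ys → All (x ≢_) ys → AllPairs (λ a b → T (lt a b)) ys →
                      AllPairs (λ a b → T (lt a b)) (insertBy lt x ys)
    insertBy-sorted x []       _             _               = [] ∷ []
    insertBy-sorted x (y ∷ ys) (x≢y ∷ x∉ys) (y<ys ∷ sorted) with lt x y in x<ᵇy
    ... | true  = (x<y ∷ All.map (lt-trans x<y) y<ys) ∷ y<ys ∷ sorted
      where
      x<y : T (lt x y)
      x<y = subst T (sym x<ᵇy) tt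
    ... | false = All-resp-↭ (↭-sym (insertBy-↭ x ys)) (lt-connex x≢y (subst T x<ᵇy) ∷ y<ys)
                  ∷ insertBy-sorted x ys x∉ys sorted

    sortBy-sorted : ∀ xs → Distinct xs → AllPairs (λ a b → T (lt a b)) (sortBy lt xs)
    sortBy-sorted []       _                  = []
    sortBy-sorted (x ∷ xs) (x∉xs ∷ distinct) =
      insertBy-sorted x (sortBy lt xs) (All-resp-↭ (↭-sym (sortBy-↭ xs)) x∉xs) (sortBy-sorted xs distinct)

-- The prefix array

module Colexicographic (S : Haps) where

  Colex : ℕ → ℕ → ℕ → Set
  Colex k a b = T (colexLessUpTo S k a b)

  colex-zero⁻ : ∀ {a b} → Colex 0 a b → a < b
  colex-zero⁻ {a} {b} = <ᵇ⇒< a b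

  colex-suc⁻ : ∀ k {a b} → Colex (suc k) a b →
               (S a (suc k) ≡ S b (suc k) × Colex k a b) ⊎ S a (suc k) < S b (suc k)
  colex-suc⁻ k {a} {b} a<b with S a (suc k) ≟ S b (suc k)
  ... | yes eq rewrite dec-true  (S a (suc k) ≟ S b (suc k)) eq = inj₁ (eq , a<b)
  ... | no  ne rewrite dec-false (S a (suc k) ≟ S b (suc k)) ne = inj₂ (<ᵇ⇒< _ _ a<b)

  colex-suc-≡ : ∀ k {a b} → S a (suc k) ≡ S b (suc k) → Colex k a b → Colex (suc k) a b
  colex-suc-≡ k {a} {b} eq a<b rewrite dec-true (S a (suc k) ≟ S b (suc k)) eq = a<b

  colex-suc-< : ∀ k {a b} → S a (suc k) < S b (suc k) → Colex (suc k) a b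
  colex-suc-< k {a} {b} lt rewrite dec-false (S a (suc k) ≟ S b (suc k)) (<⇒≢ lt) = <⇒<ᵇ lt

  colex-irrefl : ∀ k {a} → ¬ Colex k a a
  colex-irrefl zero {a} a<a = <-irrefl refl (colex-zero⁻ {a} {a} a<a)
  colex-irrefl (suc k) a<a with colex-suc⁻ k a<a
  ... | inj₁ (_ , a<a′) = colex-irrefl k a<a′
  ... | inj₂ lt        = <-irrefl refl lt

  colex-trans : ∀ k {a b c} → Colex k a b → Colex k b c → Colex k a c
  colex-trans zero {a} {b} {c} a<b b<c = <⇒<ᵇ (<-trans (colex-zero⁻ {a} {b} a<b) (colex-zero⁻ {b} {c} b<c))
  colex-trans (suc k) {a} {b} {c} a<b b<c with colex-suc⁻ k a<b | colex-suc⁻ k b<c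
  ... | inj₁ (eq₁ , a<b′) | inj₁ (eq₂ , b<c′) = colex-suc-≡ k (trans eq₁ eq₂) (colex-trans k a<b′ b<c′)
  ... | inj₁ (eq₁ , _)    | inj₂ lt₂          = colex-suc-< k (subst (_< S c (suc k)) (sym eq₁) lt₂)
  ... | inj₂ lt₁          | inj₁ (eq₂ , _)    = colex-suc-< k (subst (S a (suc k) <_) eq₂ lt₁)
  ... | inj₂ lt₁          | inj₂ lt₂          = colex-suc-< k (<-trans lt₁ lt₂)

  colex-connex : ∀ k {a b} → a ≢ b → ¬ Colex k a b → Colex k b a
  colex-connex zero {a} {b} a≢b a≮b with <-cmp a b
  ... | tri< a<b _ _ = contradiction (<⇒<ᵇ a<b) a≮b
  ... | tri≈ _ a≡b _ = contradiction a≡b a≢b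
  ... | tri> _ _ b<a = <⇒<ᵇ b<a
  colex-connex (suc k) {a} {b} a≢b a≮b with <-cmp (S a (suc k)) (S b (suc k))
  ... | tri< lt _ _ = contradiction (colex-suc-< k lt) a≮b
  ... | tri≈ _ eq _ = colex-suc-≡ k (sym eq) (colex-connex k a≢b (a≮b ∘ colex-suc-≡ k eq))
  ... | tri> _ _ gt = colex-suc-< k gt

module PrefixArray (S : Haps) (h : ℕ) where

  open Colexicographic S

  rows : List ℕ
  rows = range1 h

  column : ℕ → List ℕ
  column j = PAcol S h j

  position : ℕ → ℕ → ℕ
  position j c = posOf c (column j)

  -- φ j c = 0 when c heads column j, because `at` returns 0 at index 0.
  φ : ℕ → ℕ → ℕ
  φ j c = before c (column j)

  rows-distinct : Distinct rows
  rows-distinct = applyUpTo⁺₁ suc h (λ i<j _ → <⇒≢ (s≤s i<j))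

  rows-≢0 : ∀ {c} → c ∈ rows → c ≢ 0
  rows-≢0 c∈ with ∈-applyUpTo⁻ suc c∈
  ... | _ , _ , refl = λ ()

  column-↭ : ∀ j → column j ↭ rows
  column-↭ j = InsertionSort.sortBy-↭ (colexLess S j) rows

  column-sorted : ∀ j → AllPairs (Colex (j ∸ 1)) (column j)
  column-sorted j = InsertionSort.sortBy-sorted (colexLess S j) (colex-trans (j ∸ 1)) (colex-connex (j ∸ 1))
                      rows rows-distinct

  module Column (j : ℕ) = StrictlySorted (colex-irrefl (j ∸ 1)) (colex-trans (j ∸ 1)) (column-sorted j)

  column-length : ∀ j → length (column j) ≡ h
  column-length j = trans (↭-length (column-↭ j)) (length-applyUpTo suc h)

  ∈-column : ∀ j {c} → c ∈ rows → c ∈ column j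
  ∈-column j = ∈-resp-↭ (↭-sym (column-↭ j))

  column-∈ : ∀ j {c} → c ∈ column j → c ∈ rows
  column-∈ j = ∈-resp-↭ (column-↭ j)

  PA-∈ : ∀ j i → suc i ≤ h → PA S h j (suc i) ∈ rows
  PA-∈ j i i< = column-∈ j (at-∈ i (subst (suc i ≤_) (sym (column-length j)) i<))

  position-PA : ∀ j i → suc i ≤ h → position j (PA S h j (suc i)) ≡ suc i
  position-PA j i i< = posOf-at i (Column.distinct j) (subst (suc i ≤_) (sym (column-length j)) i<)

  PA-position : ∀ j {c} → c ∈ rows → PA S h j (position j c) ≡ c
  PA-position j c∈ = at-posOf (∈-column j c∈)

  position-∈ : ∀ j {c} → c ∈ rows → ∃[ p ] position j c ≡ suc p × suc p ≤ h
  position-∈ j c∈ with posOf-∈ (∈-column j c∈)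
  ... | p , pos≡ , p< = p , pos≡ , subst (suc p ≤_) (column-length j) p<

  1≤position : ∀ j {c} → c ∈ rows → 1 ≤ position j c
  1≤position j c∈ with position-∈ j c∈
  ... | _ , pos≡ , _ = subst (1 ≤_) (sym pos≡) (s≤s z≤n)

  position≤h : ∀ j {c} → c ∈ rows → position j c ≤ h
  position≤h j c∈ with position-∈ j c∈
  ... | _ , pos≡ , p< = subst (_≤ h) (sym pos≡) p<

  position-≢ : ∀ j i {c} → c ∈ rows → c ≢ PA S h j i → position j c ≢ i
  position-≢ j i c∈ c≢ pos≡ = c≢ (trans (sym (PA-position j c∈)) (cong (PA S h j) pos≡))

  φ-injective : ∀ j {c c′} → c ∈ rows → c′ ∈ rows → φ j c ≡ φ j c′ → φ j c ≢ 0 → c ≡ c′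
  φ-injective j c∈ c′∈ = before-injective (Column.distinct j) (∈-column j c∈) (∈-column j c′∈)

  -- c′ and c are adjacent in column t + 1 and carry the same symbol there, so nothing comes between them in
  -- column t + 2.
  φ-suc-run : ∀ t k {c} → c ∈ rows → position (suc t) c ≡ suc (suc k) →
              PBWT S h (suc t) (suc k) ≡ PBWT S h (suc t) (suc (suc k)) →
              φ (suc (suc t)) c ≡ PA S h (suc t) (suc k)
  φ-suc-run t k {c} c∈ pos≡ same-run =
    Column.before-adjacent (suc (suc t)) (∈-column (suc (suc t)) (column-∈ (suc t) c′∈)) (∈-column (suc (suc t)) c∈)
      (colex-suc-≡ t same-symbol c′<c) nothing-between
    where
    c′ : ℕ
    c′ = PA S h (suc t) (suc k)
    k< : suc (suc k) ≤ length (column (suc t))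
    k< with posOf-∈ (∈-column (suc t) c∈)
    ... | _ , pos≡′ , p< = subst (_≤ length (column (suc t))) (trans (sym pos≡′) pos≡) p<
    c′∈ : c′ ∈ column (suc t)
    c′∈ = at-∈ k (<⇒≤ k<)
    at≡c : PA S h (suc t) (suc (suc k)) ≡ c
    at≡c = trans (cong (at (column (suc t))) (sym pos≡)) (PA-position (suc t) c∈)
    same-symbol : S c′ (suc t) ≡ S c (suc t)
    same-symbol = subst (λ x → S c′ (suc t) ≡ S x (suc t)) at≡c same-run
    c′<c : Colex t c′ c
    c′<c = subst (Colex t c′) at≡c (at-sorted (column-sorted (suc t)) (n<1+n k) k<)
    nothing-between : ∀ {z} → z ∈ column (suc (suc t)) → Colex (suc t) c′ z → Colex (suc t) z c → ⊥
    nothing-between {z} z∈ c′<z z<c with colex-suc⁻ t c′<z | colex-suc⁻ t z<c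
    ... | inj₁ (_ , c′<z′) | inj₁ (_ , z<c′) =
      Column.nothing-between-consecutive (suc t) k k< (∈-column (suc t) (column-∈ (suc (suc t)) z∈))
        c′<z′ (subst (Colex t z) (sym at≡c) z<c′)
    ... | inj₁ (eq , _) | inj₂ lt = <-irrefl (trans (sym eq) same-symbol) lt
    ... | inj₂ lt | inj₁ (eq , _) = <-irrefl (trans same-symbol (sym eq)) lt
    ... | inj₂ lt₁ | inj₂ lt₂ = <-irrefl same-symbol (<-trans lt₁ lt₂)

-- Haplotype intervals

any-false : ∀ (p : ℕ → Bool) {x xs} → any p xs ≡ false → x ∈ xs → p x ≡ false
any-false p {x} any≡false x∈ with p x in px
... | false = refl
... | true  = ⊥-elim (subst T any≡false (any⁺ p (Any.map (λ { refl → subst T (sym px) tt }) x∈)))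

module Haplotypes (S : Haps) (h m : ℕ) where

  open PrefixArray S h

  NoBoundaryIn : ℕ → ℕ → ℕ → Set
  NoBoundaryIn c b e = ∀ {t} → b ≤ t → t < e → isBoundary S h m c t ≡ false

  not-runTop : ∀ j {c} → c ∈ rows → isBoundary S h m c j ≡ false → runTop S h (position j c) j ≡ false
  not-runTop j {c} c∈ not-boundary = begin
    runTop S h x j                      ≡⟨ sym (∧-identityʳ _) ⟩
    runTop S h x j ∧ true               ≡⟨ cong (runTop S h x j ∧_) (sym (dec-true (PA S h j x ≟ c) (PA-position j c∈))) ⟩
    runTop S h x j ∧ (PA S h j x ≡ᵇ c)  ≡⟨ any-false (λ y → runTop S h y j ∧ (PA S h j y ≡ᵇ c))
                                                     (∨-falseʳ not-boundary) x∈ ⟩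
    false                               ∎
    where
    open ≡-Reasoning
    x : ℕ
    x = position j c
    x∈ : x ∈ rows
    x∈ with position-∈ j c∈
    ... | p , pos≡ , p< = subst (_∈ rows) (sym pos≡) (∈-applyUpTo⁺ suc p<)
    ∨-falseʳ : ∀ {a b} → (a ∨ b) ≡ false → b ≡ false
    ∨-falseʳ {false} eq = eq

  not-runTop⇒same-run : ∀ j k → runTop S h (suc (suc k)) j ≡ false → PBWT S h j (suc (suc k)) ≡ PBWT S h j (suc k)
  not-runTop⇒same-run j k not-top = ≡ᵇ⇒≡ _ _ (subst T (sym (not-injective not-top)) tt)

  φ-stable : ∀ t {c} → c ∈ rows → isBoundary S h m c (suc t) ≡ false → φ (suc (suc t)) c ≡ φ (suc t) c
  φ-stable t {c} c∈ not-boundary with position-∈ (suc t) c∈ | not-runTop (suc t) c∈ not-boundary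
  ... | zero  , pos≡ , _ | not-top = contradiction (subst (λ x → runTop S h x (suc t) ≡ false) pos≡ not-top) λ ()
  ... | suc k , pos≡ , _ | not-top =
    trans (φ-suc-run t k c∈ pos≡ (sym (not-runTop⇒same-run (suc t) k not-top′)))
          (cong (λ p → at (column (suc t)) (p ∸ 1)) (sym pos≡))
    where
    not-top′ : runTop S h (suc (suc k)) (suc t) ≡ false
    not-top′ = subst (λ x → runTop S h x (suc t) ≡ false) pos≡ not-top

  Chain : ℕ → ℕ → List Interval → Set
  Chain c b []               = ⊤
  Chain c b ((b′ , e) ∷ Is) = b′ ≡ b × b ≤ e × NoBoundaryIn c b e × Chain c (suc e) Is

  -- `boundaries` filters with a where-bound function; abstracting over `range1 m` lets unification name it.
  boundaryFilter : ∀ c → Σ (List ℕ → List ℕ) λ F → F (range1 m) ≡ boundaries S h m c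
  boundaryFilter c = F , F-spec
    where
    F : List ℕ → List ℕ
    F = _
    F-spec : F (range1 m) ≡ boundaries S h m c
    F-spec with range1 m
    ... | js = refl

  chain-boundaryFilter : ∀ c n {a b} → b ≤ a → NoBoundaryIn c b a →
                         Chain c b (intervalsFrom b (proj₁ (boundaryFilter c) (iterate suc a n)))
  chain-boundaryFilter c zero    _   _    = tt
  chain-boundaryFilter c (suc n) {a} {b} b≤a none with isBoundary S h m c a in a-boundary
  ... | true  = refl , b≤a , none , chain-boundaryFilter c n ≤-refl (λ a<t t<a → contradiction (<-≤-trans t<a a<t) (n≮n _))
  ... | false = chain-boundaryFilter c n (m≤n⇒m≤1+n b≤a) none′
    where
    none′ : NoBoundaryIn c b (suc a)
    none′ b≤t t<1+a with m≤n⇒m<n∨m≡n (≤-pred t<1+a)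
    ... | inj₁ t<a  = none b≤t t<a
    ... | inj₂ refl = a-boundary

  chain-hapIntervals : ∀ c → Chain c 1 (hapIntervals S h m c)
  chain-hapIntervals c =
    subst (Chain c 1 ∘ intervalsFrom 1) (trans (cong F (sym (range1-iterate m))) F-spec)
      (chain-boundaryFilter c m ≤-refl (λ 1≤t t<1 → contradiction (<-≤-trans t<1 1≤t) (<-irrefl refl)))
    where
    F : List ℕ → List ℕ
    F = proj₁ (boundaryFilter c)
    F-spec : F (range1 m) ≡ boundaries S h m c
    F-spec = proj₂ (boundaryFilter c)

-- Refined segments

EndsBy : ℕ → RefSeg → Set
EndsBy j ((_ , e) , _) = e ≤ j

EndsBy-suc : ∀ {j} x → EndsBy j x → EndsBy (suc j) x
EndsBy-suc _ = m≤n⇒m≤1+n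

countOverlaps-∷ : ∀ I J t rs →
                  countOverlaps I ((J , t) ∷ rs) ≡ (if overlaps I J then suc (countOverlaps I rs) else countOverlaps I rs)
countOverlaps-∷ I J t rs with overlaps I J
... | true  = refl
... | false = refl

overlaps-empty : ∀ {b j} J → j < b → overlaps (b , j) J ≡ false
overlaps-empty {b} {j} (a , e) j<b =
  dec-false ((b ⊔ a) ≤? (j ⊓ e)) (λ le → <⇒≱ j<b (≤-trans (m≤m⊔n b a) (≤-trans le (m⊓n≤m j e))))

overlaps-extend : ∀ {b j a e} → e ≤ j → overlaps (b , suc j) (a , e) ≡ overlaps (b , j) (a , e)
overlaps-extend {b} {j} {a} e≤j =
  cong ((b ⊔ a) ≤ᵇ_) (trans (m≥n⇒m⊓n≡n (m≤n⇒m≤1+n e≤j)) (sym (m≥n⇒m⊓n≡n e≤j)))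

countOverlaps-empty : ∀ {b j} rs → j < b → countOverlaps (b , j) rs ≡ 0
countOverlaps-empty []                  _   = refl
countOverlaps-empty {b} {j} ((J , t) ∷ rs) j<b
  rewrite countOverlaps-∷ (b , j) J t rs | overlaps-empty J j<b = countOverlaps-empty rs j<b

countOverlaps-extend : ∀ {b j} rs → All (EndsBy j) rs → countOverlaps (b , suc j) rs ≡ countOverlaps (b , j) rs
countOverlaps-extend []                     []            = refl
countOverlaps-extend {b} {j} (((a , e) , t) ∷ rs) (e≤j ∷ ended)
  rewrite countOverlaps-∷ (b , suc j) (a , e) t rs | countOverlaps-∷ (b , j) (a , e) t rs
        | overlaps-extend {b} {j} {a} e≤j | countOverlaps-extend {b} rs ended = refl

countOverlaps-++ : ∀ I rs x → countOverlaps I (rs ++ [ x ]) ≤ suc (countOverlaps I rs)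
countOverlaps-++ I []             (J , t) rewrite countOverlaps-∷ I J t [] with overlaps I J
... | true  = ≤-refl
... | false = z≤n
countOverlaps-++ I ((J , t) ∷ rs) x rewrite countOverlaps-∷ I J t (rs ++ [ x ]) | countOverlaps-∷ I J t rs
  with overlaps I J
... | true  = s≤s (countOverlaps-++ I rs x)
... | false = countOverlaps-++ I rs x

countCanonical : List RefSeg → ℕ
countCanonical []             = 0
countCanonical ((_ , t) ∷ rs) = if t then suc (countCanonical rs) else countCanonical rs

countCanonical-++ : ∀ rs J t → countCanonical (rs ++ [ (J , t) ]) ≡ countCanonical rs + (if t then 1 else 0)
countCanonical-++ []                 J true  = refl
countCanonical-++ []                 J false = refl
countCanonical-++ ((_ , true)  ∷ rs) J t     = cong suc (countCanonical-++ rs J t)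
countCanonical-++ ((_ , false) ∷ rs) J t     = countCanonical-++ rs J t

-- The decomposition algorithm

update-same : ∀ {A : Set} (f : ℕ → A) c v → update f c v c ≡ v
update-same f c v rewrite ≡ᵇ-refl c = refl

update-other : ∀ {A : Set} (f : ℕ → A) {c k} v → k ≢ c → update f c v k ≡ f k
update-other f {c} {k} v k≢c rewrite dec-false (k ≟ c) k≢c = refl

update-elim : ∀ {A : Set} (P : ℕ → A → Set) (f : ℕ → A) c v → P c v → (∀ {k} → k ≢ c → P k (f k)) →
              ∀ k → P k (update f c v k)
update-elim P f c v Pcv Pothers k with k ≟ c
... | yes refl rewrite ≡ᵇ-refl k = Pcv
... | no  k≢c  rewrite dec-false (k ≟ c) k≢c = Pothers k≢c

module Decomposition (S : Haps) (h m d : ℕ) where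

  open PrefixArray S h
  open Haplotypes S h m

  Covers : ℕ → List Interval → Set
  Covers t []            = ⊤
  Covers t ((b , e) ∷ _) = b ≤ t × t ≤ e

  chain-covers : ∀ {c t} Is → Chain c t Is → Covers t Is
  chain-covers []             _                  = tt
  chain-covers ((b , e) ∷ _) (refl , t≤e , _) = ≤-refl , t≤e

  -- While column j is scanned up to row i, the head of L c covers the next column in which c is visited.
  HeadInvariant : ℕ → ℕ → ℕ → List Interval → Set
  HeadInvariant j i c Is = (position j c < i → Covers (suc j) Is) × (i ≤ position j c → Covers j Is)

  headCredit : ℕ → List Interval → List RefSeg → ℕ
  headCredit j []            rs = 0
  headCredit j ((b , _) ∷ _) rs = countOverlaps (b , j) rs

  credit : ℕ → State → ℕ → ℕ
  credit j s c = headCredit j (L s c) (RS s (φ j c))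

  pending : ℕ → State → ℕ
  pending j s = sumOver rows (credit j s) + sumOver rows (length ∘ L s)

  canonicalTotal : State → ℕ
  canonicalTotal s = sumOver rows (countCanonical ∘ RS s)

  record Invariant (j i : ℕ) (s : State) : Set where
    field
      chains    : ∀ c → ∃[ b ] Chain c b (L s c)
      heads     : ∀ {c} → c ∈ rows → HeadInvariant j i c (L s c)
      ended     : ∀ c → All (EndsBy j) (RS s c)
      canonical : canonicalTotal s ≤ actives s
      potential : d * actives s + pending j s ≤ totalIntervals S h m + actives s

  headCredit-fresh : ∀ {c j} Is rs → Chain c (suc j) Is → headCredit j Is rs ≡ 0
  headCredit-fresh []            rs _          = refl
  headCredit-fresh ((_ , _) ∷ _) rs (refl , _) = countOverlaps-empty rs ≤-refl

  headCredit-++ : ∀ j Is rs x → headCredit j Is (rs ++ [ x ]) ≤ suc (headCredit j Is rs)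
  headCredit-++ j []            rs x = z≤n
  headCredit-++ j ((b , _) ∷ _) rs x = countOverlaps-++ (b , j) rs x

  headCredit-[] : ∀ j Is → headCredit j Is [] ≡ 0
  headCredit-[] j []      = refl
  headCredit-[] j (_ ∷ _) = refl

  initial : Invariant 1 1 (initState S h m)
  initial = record
    { chains    = λ c → 1 , chain-hapIntervals c
    ; heads     = λ c∈ → (λ p<1 → contradiction p<1 (≤⇒≯ (1≤position 1 c∈))) ,
                         (λ _ → chain-covers _ (chain-hapIntervals _))
    ; ended     = λ _ → []
    ; canonical = ≤-reflexive (sumOver-zero rows (λ _ → refl))
    ; potential = ≤-reflexive (begin
        d * 0 + (sumOver rows (credit 1 s₀) + Y)  ≡⟨ cong₂ (λ x y → x + (y + Y)) (*-zeroʳ d)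
                                                           (sumOver-zero rows (λ {c} _ → headCredit-[] 1 (L s₀ c))) ⟩
        Y                                           ≡⟨ sym (+-identityʳ Y) ⟩
        Y + 0                                       ∎)
    }
    where
    open ≡-Reasoning
    s₀ : State
    s₀ = initState S h m
    Y : ℕ
    Y = totalIntervals S h m

  credit-next-column : ∀ t {s} → Invariant (suc t) (suc h) s → ∀ {c} → c ∈ rows →
                       credit (suc (suc t)) s c ≤ credit (suc t) s c
  credit-next-column t {s} inv {c} c∈
    with L s c | Invariant.chains inv c | proj₁ (Invariant.heads inv c∈) (s≤s (position≤h (suc t) c∈))
  ... | []          | _                         | _                 = z≤n
  ... | (b , e) ∷ _ | (_ , refl , _ , none , _) | (b≤2+t , 2+t≤e)
    rewrite countOverlaps-extend {b} (RS s (φ (suc (suc t)) c)) (Invariant.ended inv _)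
    with m≤n⇒m<n∨m≡n b≤2+t
  ...   | inj₁ b<2+t rewrite φ-stable t c∈ (none (≤-pred b<2+t) 2+t≤e) = ≤-refl
  ...   | inj₂ refl  = ≤-trans (≤-reflexive (countOverlaps-empty (RS s (φ (suc (suc t)) c)) ≤-refl)) z≤n

  next-column : ∀ t {s} → Invariant (suc t) (suc h) s → Invariant (suc (suc t)) 1 s
  next-column t {s} inv = record
    { chains    = chains
    ; heads     = λ c∈ → (λ p<1 → contradiction p<1 (≤⇒≯ (1≤position (suc (suc t)) c∈))) ,
                         (λ _ → proj₁ (heads c∈) (s≤s (position≤h (suc t) c∈)))
    ; ended     = λ c → All.map (λ {x} → EndsBy-suc x) (ended c)
    ; canonical = canonical
    ; potential = ≤-trans (+-monoʳ-≤ (d * actives s) (+-monoˡ-≤ _ (sumOver-mono rows (credit-next-column t inv))))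
                          potential
    }
    where open Invariant inv

  module Visit {j i s} (i<h : i < h) (inv : Invariant j (suc i) s) where

    open Invariant inv

    c : ℕ
    c = PA S h j (suc i)

    c∈ : c ∈ rows
    c∈ = PA-∈ j i i<h

    position-c : position j c ≡ suc i
    position-c = position-PA j i i<h

    φ-c : φ j c ≡ PA S h j i
    φ-c = cong (λ p → at (column j) (p ∸ 1)) position-c

    heads-visited : ∀ {Is} → Covers (suc j) Is → HeadInvariant j (suc (suc i)) c Is
    heads-visited cov = (λ _ → cov) , (λ 2+i≤p → contradiction (subst (suc (suc i) ≤_) position-c 2+i≤p) (n≮n _))

    heads-others : ∀ {k Is} → k ∈ rows → k ≢ c → HeadInvariant j (suc i) k Is → HeadInvariant j (suc (suc i)) k Is
    heads-others k∈ k≢c (visited , unvisited) =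
      (λ p<2+i → visited (≤∧≢⇒< (≤-pred p<2+i) (position-≢ j (suc i) k∈ k≢c))) ,
      (λ 2+i≤p → unvisited (≤-trans (n≤1+n _) 2+i≤p))

    head-facts : ∀ {b e rest} → L s c ≡ (b , e) ∷ rest → b ≤ j × j ≤ e × NoBoundaryIn c b e × Chain c (suc e) rest
    head-facts L≡ with chains c | proj₂ (heads c∈) (≤-reflexive (sym position-c))
    ... | _ , chain | unvisited with subst (Chain c _) L≡ chain | subst (Covers j) L≡ unvisited
    ...   | refl , _ , none , rest-chain | b≤j , j≤e = b≤j , j≤e , none , rest-chain

    skip : Covers (suc j) (L s c) → Invariant j (suc (suc i)) s
    skip cov = record { chains = chains ; heads = heads′ ; ended = ended ; canonical = canonical ; potential = potential }
      where
      heads′ : ∀ {k} → k ∈ rows → HeadInvariant j (suc (suc i)) k (L s k)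
      heads′ {k} k∈ with k ≟ c
      ... | yes refl = heads-visited cov
      ... | no  k≢c  = heads-others k∈ k≢c (heads k∈)

    module Split (Lnew : List Interval) (J : Interval) (t : Bool) where

      s′ : State
      s′ = st (update (L s) c Lnew) (update (RS s) c (RS s c ++ [ (J , t) ])) ((if t then 1 else 0) + actives s)

      credit-others : ∀ {k} → k ≢ c → credit j s′ k ≤ credit j s k + (if φ j k ≡ᵇ c then 1 else 0)
      credit-others {k} k≢c rewrite update-other (L s) Lnew k≢c with φ j k ≟ c
      ... | yes φk≡c rewrite φk≡c | update-same (RS s) c (RS s c ++ [ (J , t) ]) | ≡ᵇ-refl c =
        ≤-trans (headCredit-++ j (L s k) (RS s c) (J , t)) (≤-reflexive (+-comm 1 _))
      ... | no  φk≢c rewrite update-other (RS s) (RS s c ++ [ (J , t) ]) φk≢c | dec-false (φ j k ≟ c) φk≢c =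
        m≤m+n _ 0

      φ-unique : ∀ {k k′} → k ∈ rows → k′ ∈ rows → T (φ j k ≡ᵇ c) → T (φ j k′ ≡ᵇ c) → k ≡ k′
      φ-unique k∈ k′∈ φk≡c φk′≡c =
        φ-injective j k∈ k′∈ (trans (≡ᵇ⇒≡ _ _ φk≡c) (sym (≡ᵇ⇒≡ _ _ φk′≡c)))
          (λ φk≡0 → rows-≢0 c∈ (trans (sym (≡ᵇ⇒≡ _ _ φk≡c)) φk≡0))

      lengths-split : sumOver rows (length ∘ L s′) + length (L s c) ≡ sumOver rows (length ∘ L s) + length Lnew
      lengths-split = trans (sumOver-update rows-distinct c∈ (λ _ k≢c → cong length (update-other (L s) Lnew k≢c)))
                            (cong (λ Is → _ + length Is) (update-same (L s) c Lnew))

      canonical-split : canonicalTotal s′ ≤ (if t then 1 else 0) + actives s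
      canonical-split = +-cancelʳ-≤ (countCanonical (RS s c)) _ _ (begin
        canonicalTotal s′ + countCanonical (RS s c)
                                                       ≡⟨ sumOver-update rows-distinct c∈ others ⟩
        canonicalTotal s + countCanonical (update (RS s) c (RS s c ++ [ (J , t) ]) c)
                                                       ≡⟨ cong (λ rs → canonicalTotal s + countCanonical rs)
                                                               (update-same (RS s) c _) ⟩
        canonicalTotal s + countCanonical (RS s c ++ [ (J , t) ])
                                                       ≡⟨ cong (canonicalTotal s +_) (countCanonical-++ (RS s c) J t) ⟩
        canonicalTotal s + (countCanonical (RS s c) + flag)
                                                       ≤⟨ +-monoˡ-≤ _ canonical ⟩
        actives s + (countCanonical (RS s c) + flag)  ≡⟨ shuffle (actives s) _ flag ⟩
        (flag + actives s) + countCanonical (RS s c)  ∎)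
        where
        open ≤-Reasoning
        flag : ℕ
        flag = if t then 1 else 0
        others : ∀ {k} → k ∈ rows → k ≢ c → countCanonical (RS s′ k) ≡ countCanonical (RS s k)
        others _ k≢c = cong countCanonical (update-other (RS s) _ k≢c)
        shuffle : ∀ a b c → a + (b + c) ≡ (c + a) + b
        shuffle = solve-∀

      module _ (fresh : Chain c (suc j) Lnew) where

        credit-c : credit j s′ c ≡ 0
        credit-c rewrite update-same (L s) c Lnew = headCredit-fresh Lnew _ fresh

        credits-split : sumOver rows (credit j s′) + credit j s c ≤ sumOver rows (credit j s) + 1
        credits-split = ≤-trans (sumOver-update-≤ rows-distinct c∈ credit-c (λ _ → credit-others))
                                (+-monoʳ-≤ _ (sumOver-indicator-≤1 (λ k → φ j k ≡ᵇ c) rows-distinct φ-unique))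

        pending-split : pending j s′ + (credit j s c + length (L s c)) ≤ pending j s + suc (length Lnew)
        pending-split = begin
          (C′ + N′) + (credit j s c + length (L s c))  ≡⟨ +-interchange C′ N′ _ _ ⟩
          (C′ + credit j s c) + (N′ + length (L s c))  ≤⟨ +-mono-≤ credits-split (≤-reflexive lengths-split) ⟩
          (C + 1) + (N + length Lnew)                  ≡⟨ shuffle C N (length Lnew) ⟩
          (C + N) + suc (length Lnew)                  ∎
          where
          open ≤-Reasoning
          C′ N′ C N : ℕ
          C′ = sumOver rows (credit j s′)
          N′ = sumOver rows (length ∘ L s′)
          C  = sumOver rows (credit j s)
          N  = sumOver rows (length ∘ L s)
          shuffle : ∀ a b c → (a + 1) + (b + c) ≡ (a + b) + suc c
          shuffle = solve-∀

        invariant : EndsBy j (J , t) → d * actives s′ + pending j s′ ≤ totalIntervals S h m + actives s′ →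
                    Invariant j (suc (suc i)) s′
        invariant J-ends potential′ = record
          { chains    = update-elim (λ k Is → ∃[ b ] Chain k b Is) (L s) c Lnew (suc j , fresh) (λ {k} _ → chains k)
          ; heads     = λ {k} → update-elim (λ k Is → k ∈ rows → HeadInvariant j (suc (suc i)) k Is) (L s) c Lnew
                                   (λ _ → heads-visited (chain-covers Lnew fresh))
                                   (λ k≢c k∈ → heads-others k∈ k≢c (heads k∈)) k
          ; ended     = update-elim (λ _ rs → All (EndsBy j) rs) (RS s) c _
                                    (All.++⁺ (ended c) (J-ends ∷ [])) (λ {k} _ → ended k)
          ; canonical = canonical-split
          ; potential = potential′
          }


    passive : ∀ {b e rest} → L s c ≡ (b , e) ∷ rest → j ≡ e →
              Invariant j (suc (suc i)) (Split.s′ rest (b , e) false)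
    passive {b} {e} {rest} L≡ refl with head-facts L≡
    ... | _ , _ , _ , rest-chain =
      invariant rest-chain ≤-refl (≤-trans (+-monoʳ-≤ (d * actives s) pending≤) potential)
      where
      open Split rest (b , e) false
      pending≤ : pending j s′ ≤ pending j s
      pending≤ = +-cancelʳ-≤ (suc (length rest)) _ _ (begin
        pending j s′ + suc (length rest)                 ≤⟨ +-monoʳ-≤ (pending j s′) (m≤n+m _ (credit j s c)) ⟩
        pending j s′ + (credit j s c + suc (length rest)) ≡⟨ cong (λ Is → pending j s′ + (credit j s c + length Is))
                                                                   (sym L≡) ⟩
        pending j s′ + (credit j s c + length (L s c))   ≤⟨ pending-split rest-chain ⟩
        pending j s + suc (length rest)                  ∎)
        where open ≤-Reasoning

    active : ∀ {b e rest} → L s c ≡ (b , e) ∷ rest → j ≢ e → countOverlaps (b , j) (RS s (PA S h j i)) ≡ d →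
             Invariant j (suc (suc i)) (Split.s′ ((suc j , e) ∷ rest) (b , j) true)
    active {b} {e} {rest} L≡ j≢e overlaps≡d with head-facts L≡
    ... | b≤j , j≤e , none , rest-chain = invariant fresh ≤-refl (begin
        d * suc A + pending j s′        ≡⟨ cong (_+ pending j s′) (*-suc d A) ⟩
        (d + d * A) + pending j s′      ≡⟨ shuffle d (d * A) (pending j s′) ⟩
        d * A + (pending j s′ + d)      ≤⟨ +-monoʳ-≤ (d * A) pending+d ⟩
        d * A + (pending j s + 1)       ≡⟨ sym (+-assoc (d * A) _ 1) ⟩
        (d * A + pending j s) + 1       ≤⟨ +-monoˡ-≤ 1 potential ⟩
        (totalIntervals S h m + A) + 1  ≡⟨ +-assoc (totalIntervals S h m) A 1 ⟩
        totalIntervals S h m + (A + 1)  ≡⟨ cong (totalIntervals S h m +_) (+-comm A 1) ⟩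
        totalIntervals S h m + suc A    ∎)
      where
      open ≤-Reasoning
      open Split ((suc j , e) ∷ rest) (b , j) true
      A : ℕ
      A = actives s
      shuffle : ∀ a b c → (a + b) + c ≡ b + (c + a)
      shuffle = solve-∀
      fresh : Chain c (suc j) ((suc j , e) ∷ rest)
      fresh = refl , ≤∧≢⇒< j≤e j≢e , (λ j<t t<e → none (≤-trans b≤j (<⇒≤ j<t)) t<e) , rest-chain
      credit-c≡d : credit j s c ≡ d
      credit-c≡d = trans (cong₂ (headCredit j) L≡ (cong (RS s) φ-c)) overlaps≡d
      pending+d : pending j s′ + d ≤ pending j s + 1
      pending+d = +-cancelʳ-≤ (suc (length rest)) _ _ (begin
        (pending j s′ + d) + suc (length rest)                   ≡⟨ +-assoc (pending j s′) d _ ⟩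
        pending j s′ + (d + suc (length rest))                   ≡⟨ cong₂ (λ x Is → pending j s′ + (x + length Is))
                                                                           (sym credit-c≡d) (sym L≡) ⟩
        pending j s′ + (credit j s c + length (L s c))           ≤⟨ pending-split fresh ⟩
        pending j s + suc (suc (length rest))                    ≡⟨ sym (+-assoc (pending j s) 1 _) ⟩
        (pending j s + 1) + suc (length rest)                    ∎)

    visit : Invariant j (suc (suc i)) (step S h d s j (suc i))
    visit with L s (PA S h j (suc i)) in L≡
    ... | [] = skip (subst (Covers (suc j)) (sym L≡) tt)
    ... | (b , e) ∷ rest with j ≟ e
    ...   | yes j≡e rewrite dec-true (j ≟ e) j≡e = passive L≡ j≡e
    ...   | no  j≢e rewrite dec-false (j ≟ e) j≢e
      with (1 <ᵇ suc i) ∧ (countOverlaps (b , j) (RS s (PA S h j i)) ≡ᵇ d) in active?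
    ...     | true  = active L≡ j≢e (≡ᵇ⇒≡ _ _ (proj₂ (Equivalence.to T-∧ (subst T (sym active?) tt))))
    ...     | false with head-facts L≡
    ...       | b≤j , j≤e , _ = skip (subst (Covers (suc j)) (sym L≡) (m≤n⇒m≤1+n b≤j , ≤∧≢⇒< j≤e j≢e))

  column-invariant : ∀ t {s} → Invariant (suc t) 1 s →
                     Invariant (suc (suc t)) 1 (foldl (λ s′ i → step S h d s′ (suc t) i) s (range1 h))
  column-invariant t {s} inv =
    next-column t (subst (Invariant (suc t) (suc h) ∘ foldl scan s) (sym (range1-iterate h))
      (foldl-iterate-invariant (Invariant (suc t)) scan h visit-row inv))
    where
    scan : State → ℕ → State
    scan s′ i = step S h d s′ (suc t) i
    visit-row : ∀ {i s} → 1 ≤ i → i < 1 + h → Invariant (suc t) i s → Invariant (suc t) (suc i) (scan s i)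
    visit-row {suc i} _ i<h inv = Visit.visit (≤-pred i<h) inv

  final : Invariant (suc m) 1 (runAlg S h m d)
  final = subst (Invariant (suc m) 1 ∘ foldl scan (initState S h m)) (sym (range1-iterate m))
            (foldl-iterate-invariant (λ j s → Invariant j 1 s) scan m scan-column initial)
    where
    scan : State → ℕ → State
    scan s j = foldl (λ s′ i → step S h d s′ j i) s (range1 h)
    scan-column : ∀ {j s} → 1 ≤ j → j < 1 + m → Invariant j 1 s → Invariant (suc j) 1 (scan s j)
    scan-column {suc t} _ _ = column-invariant t

  -- `canonicalCount` counts with a where-bound filter; abstracting over its arguments lets unification name the sum.
  canonicalCount≡canonicalTotal : canonicalCount S h m d ≡ canonicalTotal (runAlg S h m d)
  canonicalCount≡canonicalTotal = trans (sym G-spec) (G≡ (RS (runAlg S h m d)) rows)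
    where
    G : (ℕ → List RefSeg) → List ℕ → ℕ
    G = _
    G-spec : G (RS (runAlg S h m d)) (range1 h) ≡ canonicalCount S h m d
    G-spec with runAlg S h m d
    ... | s with RS s | range1 h
    ...   | R | ks = refl
    G-singleton : ∀ rs → G (λ _ → rs) [ 0 ] ≡ countCanonical rs + 0
    G-singleton []                 = refl
    G-singleton ((_ , true)  ∷ rs) = cong suc (G-singleton rs)
    G-singleton ((_ , false) ∷ rs) = G-singleton rs
    G≡ : ∀ R ks → G R ks ≡ sumOver ks (countCanonical ∘ R)
    G≡ R []       = refl
    G≡ R (k ∷ ks) = cong₂ _+_ (+-cancelʳ-≡ 0 _ _ (G-singleton (R k))) (G≡ R ks)

  actives-bound : d * actives (runAlg S h m d) ≤ totalIntervals S h m + actives (runAlg S h m d)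
  actives-bound = ≤-trans (m≤m+n _ _) (Invariant.potential final)

  canonical-bound : canonicalCount S h m d ≤ actives (runAlg S h m d)
  canonical-bound = subst (_≤ actives (runAlg S h m d)) (sym canonicalCount≡canonicalTotal) (Invariant.canonical final)

≤-ceilDiv : ∀ {a y} k → suc k * a ≤ y → a ≤ ceilDiv y (suc k)
≤-ceilDiv {a} {y} k ka≤y = begin
  a                    ≡⟨ sym (m*n/n≡m a (suc k)) ⟩
  (a * suc k) / suc k  ≤⟨ /-monoˡ-≤ (suc k) (≤-trans (≤-reflexive (*-comm a (suc k))) ka≤y) ⟩
  y / suc k            ≤⟨ /-monoˡ-≤ (suc k) (m≤m+n y k) ⟩
  (y + k) / suc k      ∎
  where open ≤-Reasoning

lemma13 : (S : Haps) (h m d : ℕ) → 1 < d →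
    (actives (runAlg S h m d) ≤ ceilDiv (totalIntervals S h m) (d ∸ 1))
    × (canonicalCount S h m d ≤ ceilDiv (totalIntervals S h m) (d ∸ 1))
lemma13 S h m d@(suc (suc k)) (s≤s (s≤s z≤n)) = actives≤ , ≤-trans canonical-bound actives≤
  where
  open Decomposition S h m d
  A Y : ℕ
  A = actives (runAlg S h m d)
  Y = totalIntervals S h m
  actives≤ : A ≤ ceilDiv Y (suc k)
  actives≤ = ≤-ceilDiv k (+-cancelˡ-≤ A _ _ (subst (d * A ≤_) (+-comm Y A) actives-bound))
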